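{- For every limit ordinal $\beta<\varepsilon_\omega$, every $\alpha<\beta$ and every natural number $n>1$: if $\mathrm{psn}(\alpha)<n$ then $\alpha<\beta[n]$.
   Context: $\varepsilon_{ -1}=\omega$; $\varepsilon_m$ ($m\ge0$) is the $m$-th epsilon number. $\mathrm{tow}_0(\xi)=1$, $\mathrm{tow}_{n+1}(\xi)=\xi^{\mathrm{tow}_n(\xi)}$. $l(\alpha)=\min\{n:\alpha<\varepsilon_n\}$, $h(\alpha)=\min\{n:\alpha<\mathrm{tow}_n(\varepsilon_{l(\alpha)-1})\}$. Normal form: $\alpha=\varepsilon_j^{\alpha_0}\xi_0+\dots+\varepsilon_j^{\alpha_s}\xi_s$ with $j=l(\alpha)-1$, $\alpha_0>\dots>\alpha_s$, $0<\xi_i<\varepsilon_j$. Pseudonorm: $\mathrm{psn}(\alpha)=\alpha$ for $\alpha<\omega$, else $\max\{h(\alpha),\mathrm{psn}(\alpha_i),\mathrm{psn}(\xi_i)\}$. Fundamental sequences for limit $\lambda$ in normal form with base $\varepsilon_j$: $\omega[n]=n$; $\varepsilon_j[n]=\mathrm{tow}_n(\varepsilon_{j-1})$ for $j\ge0$; $(\varepsilon_j^{\gamma+1})[n]=\varepsilon_j^{\gamma}\cdot\varepsilon_j[n]$; $(\varepsilon_j^{\psi})[n]=\varepsilon_j^{\psi[n]}$ for $\psi$ limit; $(\varepsilon_j^{\psi}\cdot(\gamma+1))[n]=\varepsilon_j^{\psi}\gamma+\varepsilon_j^{\psi}[n]$; $(\varepsilon_j^{\psi}\cdot\xi)[n]=\varepsilon_j^{\psi}\cdot\xi[n]$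 for $\xi$ limit; $(\varepsilon_j^{\lambda_0}\xi_0+\dots+\varepsilon_j^{\lambda_s}\xi_s)[n]=\varepsilon_j^{\lambda_0}\xi_0+\dots+\varepsilon_j^{\lambda_{s-1}}\xi_{s-1}+(\varepsilon_j^{\lambda_s}\xi_s)[n]$. -}

module Defs where

open import Data.Nat using (ℕ; zero; suc; _+_; _≤_; _<_; _⊔_)
open import Data.List using (List; []; _∷_; _++_)
open import Data.Product using (_×_; _,_; ∃)
open import Data.Maybe using (Maybe; just; nothing)
open import Data.Bool using (Bool; true; false; if_then_else_)
open import Data.Unit using (⊤)
open import Data.Empty using (⊥)
open import Relation.Nullary using (¬_)
open import Relation.Binary.PropositionalEquality using (_≡_)

-- Ordinal notations for the ordinals below ε_ω, in the ε-base normal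
-- form of the paper.
--
--   fin a        : the finite ordinal a
--   nf k ts      : Σ_i B_k ^ (e_i) · ξ_i   for ts = (e_0 , ξ_0) ∷ …
--                  where the base is B_0 = ω = ε_{-1} and B_{m+1} = ε_m,
--                  i.e. B_k = ε_{k-1}.
--
-- Well-formed terms (WF) are exactly the paper's normal forms:
-- nf k ts with base ε_j, j = k - 1 = l(α) - 1.

data Tm : Set where
  fin : ℕ → Tm
  nf  : ℕ → List (Tm × Tm) → Tm

-- l(α) = min{n : α < ε_n}; for a well-formed term it is read off
-- from the base of its normal form.
lev : Tm → ℕ
lev (fin _)  = 0
lev (nf k _) = k

data Cmp : Set where
  lt eq gt : Cmp

cmpℕ : ℕ → ℕ → Cmp
cmpℕ zero    zero    = eq
cmpℕ zero    (suc _) = lt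
cmpℕ (suc _) zero    = gt
cmpℕ (suc a) (suc b) = cmpℕ a b

thenCmp : Cmp → Cmp → Cmp
thenCmp lt _ = lt
thenCmp eq c = c
thenCmp gt _ = gt

mutual
  cmp : Tm → Tm → Cmp
  cmp (fin a)   (fin b)   = cmpℕ a b
  cmp (fin _)   (nf _ _)  = lt
  cmp (nf _ _)  (fin _)   = gt
  cmp (nf k xs) (nf k' ys) = thenCmp (cmpℕ k k') (cmpL xs ys)

  cmpL : List (Tm × Tm) → List (Tm × Tm) → Cmp
  cmpL []            []            = eq
  cmpL []            (_ ∷ _)       = lt
  cmpL (_ ∷ _)       []            = gt
  cmpL ((a , c) ∷ xs) ((b , d) ∷ ys) =
    thenCmp (cmp a b) (thenCmp (cmp c d) (cmpL xs ys))

infix 4 _<ₒ_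
_<ₒ_ : Tm → Tm → Set
α <ₒ β = cmp α β ≡ lt

isLt : Cmp → Bool
isLt lt = true
isLt eq = false
isLt gt = false

-- bound on coefficients: ξ < B_k and ξ > 0
CoefOK : ℕ → Tm → Set
CoefOK zero    c = ∃ λ a → c ≡ fin (suc a)
CoefOK (suc m) c = lev c ≤ m × ¬ (c ≡ fin 0)

Decr : List (Tm × Tm) → Set
Decr []                           = ⊤
Decr (_ ∷ [])                     = ⊤
Decr ((e , _) ∷ (e' , c') ∷ ts)   = (e' <ₒ e) × Decr ((e' , c') ∷ ts)

-- the leading exponent is ≥ 1 (so that l(α) is really the base level)
LeadOK : List (Tm × Tm) → Set
LeadOK []            = ⊥
LeadOK ((e , _) ∷ _) = ¬ (e ≡ fin 0)

mutual
  WF : Tm → Set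
  WF (fin _)   = ⊤
  WF (nf k ts) = LeadOK ts × Decr ts × WFL k ts

  -- exponents e satisfy e < ε_k (so that B_k^e < ε_k)
  WFL : ℕ → List (Tm × Tm) → Set
  WFL k []             = ⊤
  WFL k ((e , c) ∷ ts) = WF e × lev e ≤ k × WF c × CoefOK k c × WFL k ts

mk : ℕ → List (Tm × Tm) → Tm
mk k []                      = fin 0
mk k ((fin zero , c) ∷ [])   = c
mk k ts                      = nf k ts

mutual
  sucT : Tm → Tm
  sucT (fin a)   = fin (suc a)
  sucT (nf k ts) = nf k (sucL ts)

  sucL : List (Tm × Tm) → List (Tm × Tm)
  sucL []                      = (fin 0 , fin 1) ∷ []
  sucL ((fin zero , c) ∷ [])   = (fin zero , sucT c) ∷ []
  sucL ((e , c) ∷ [])          = (e , c) ∷ (fin 0 , fin 1) ∷ []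
  sucL (t ∷ t' ∷ ts)           = t ∷ sucL (t' ∷ ts)

IsLimit : Tm → Set
IsLimit β = ¬ (β ≡ fin 0) × ((γ : Tm) → WF γ → ¬ (sucT γ ≡ β))

mapMaybe : {A B : Set} → (A → B) → Maybe A → Maybe B
mapMaybe f (just x) = just (f x)
mapMaybe f nothing  = nothing

mutual
  predOf : Tm → Maybe Tm
  predOf (fin zero)    = nothing
  predOf (fin (suc a)) = just (fin a)
  predOf (nf k ts)     = mapMaybe (mk k) (predL ts)

  predL : List (Tm × Tm) → Maybe (List (Tm × Tm))
  predL []                      = nothing
  predL ((fin zero , c) ∷ [])   = predC (predOf c)
  predL ((e , c) ∷ [])          = nothing
  predL (t ∷ t' ∷ ts)           = mapMaybe (t ∷_) (predL (t' ∷ ts))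

  predC : Maybe Tm → Maybe (List (Tm × Tm))
  predC nothing           = nothing
  predC (just (fin zero)) = just []
  predC (just c')         = just ((fin zero , c') ∷ [])

-- Towers: towB k n = tow_n(B_k) = tow_n(ε_{k-1})

towB : ℕ → ℕ → Tm
towB k zero    = fin 1
towB k (suc n) = nf k ((towB k n , fin 1) ∷ [])

baseFS : ℕ → ℕ → Tm
baseFS zero    n = fin n
baseFS (suc m) n = towB m n

coefTerm : Tm → Tm → List (Tm × Tm)
coefTerm ψ (fin zero) = []
coefTerm ψ c          = (ψ , c) ∷ []

mutual
  fs : Tm → ℕ → Tm
  fs (fin _)   n = fin 0          -- not used: finite ordinals are not limits
  fs (nf k ts) n = mk k (fsL k ts n)

  fsL : ℕ → List (Tm × Tm) → ℕ → List (Tm × Tm)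
  fsL k []              n = []
  fsL k ((ψ , ξ) ∷ [])  n = fsTerm k ψ ξ (predOf ξ) n
  fsL k (t ∷ t' ∷ ts)   n = t ∷ fsL k (t' ∷ ts) n

  -- (B_k^ψ · ξ)[n], given predOf ξ
  fsTerm : ℕ → Tm → Tm → Maybe Tm → ℕ → List (Tm × Tm)
  fsTerm k ψ ξ (just γ) n = coefTerm ψ γ ++ fsPow k ψ n
  fsTerm k ψ ξ nothing  n = coefTerm ψ (fs ξ n)

  fsPow : ℕ → Tm → ℕ → List (Tm × Tm)
  fsPow k ψ n = fsPow' k ψ (predOf ψ) n

  fsPow' : ℕ → Tm → Maybe Tm → ℕ → List (Tm × Tm)
  fsPow' k ψ (just γ) n = coefTerm γ (baseFS k n)
  fsPow' k (fin zero) nothing n = []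
  fsPow' k ψ nothing  n = (fs ψ n , fin 1) ∷ []

-- least n < fuel with P n (fuel if none)
searchFrom : (ℕ → Bool) → ℕ → ℕ → ℕ
searchFrom P s zero    = s
searchFrom P s (suc f) = if P s then s else searchFrom P (suc s) f

mutual
  depth : Tm → ℕ
  depth (fin _)   = 0
  depth (nf _ ts) = suc (depthL ts)

  depthL : List (Tm × Tm) → ℕ
  depthL []             = 0
  depthL ((e , _) ∷ ts) = depth e ⊔ depthL ts

-- h(α) = min{n : α < tow_n(ε_{l(α)-1})}; the minimum is always below
-- depth α + 2, so searching n < depth α + 3 computes it exactly.
h : Tm → ℕ
h α = searchFrom (λ n → isLt (cmp α (towB (lev α) n))) 0 (depth α + 3)

mutual
  psn : Tm → ℕ
  psn (fin a)   = a
  psn (nf k ts) = h (nf k ts) ⊔ psnL ts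

  psnL : List (Tm × Tm) → ℕ
  psnL []             = 0
  psnL ((e , c) ∷ ts) = psn e ⊔ psn c ⊔ psnL ts

module Submission where

-- The proof is a simultaneous structural induction on the normal form of β,
-- following the clauses that define β[n].  A normal form Σ B^ψᵢ·ξᵢ is ordered
-- lexicographically and β[n] only changes its last term B^ψ·ξ: if ξ is a
-- limit we use the claim for ξ; if ξ = γ + 1 then β[n] ends in
-- B^ψ·γ + B^ψ[n], and an admissible list below B^ψ·(γ+1) is either below
-- B^ψ·γ or continues below B^ψ, where the claim for B^ψ[n] applies.  For
-- B^(γ+1)[n] = B^γ·B_k[n] the key estimate is c < B_k[n] for admissible
-- coefficients with psn c < n, which comes from c < tow_{h(c)} and h(c) ≤ psn c.

open import Defs
open import Data.Nat using (ℕ; zero; suc; _+_; _≤_; _<_; _⊔_; z≤n; s≤s)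
open import Data.Nat.Properties
open import Data.Bool using (Bool; true; false)
open import Data.List using (List; []; _∷_)
open import Data.Product using (_×_; _,_; Σ; proj₁)
open import Data.Maybe using (just; nothing)
open import Data.Unit using (⊤; tt)
open import Data.Sum using (_⊎_; inj₁; inj₂)
open import Data.Empty using (⊥-elim)
open import Relation.Nullary using (¬_)
open import Relation.Binary.PropositionalEquality using (_≡_; _≢_; refl; sym; trans; cong; cong₂; subst)

cmpℕ-refl : ∀ a → cmpℕ a a ≡ eq
cmpℕ-refl zero    = refl
cmpℕ-refl (suc a) = cmpℕ-refl a

cmpℕ-eq : ∀ a b → cmpℕ a b ≡ eq → a ≡ b
cmpℕ-eq zero    zero    _ = refl
cmpℕ-eq zero    (suc b) ()
cmpℕ-eq (suc a) zero    ()
cmpℕ-eq (suc a) (suc b) p = cong suc (cmpℕ-eq a b p)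

cmpℕ-lt⇒< : ∀ a b → cmpℕ a b ≡ lt → a < b
cmpℕ-lt⇒< zero    (suc b) _ = s≤s z≤n
cmpℕ-lt⇒< (suc a) (suc b) p = s≤s (cmpℕ-lt⇒< a b p)
cmpℕ-lt⇒< zero    zero    ()
cmpℕ-lt⇒< (suc a) zero    ()

<⇒cmpℕ-lt : ∀ {a b} → a < b → cmpℕ a b ≡ lt
<⇒cmpℕ-lt {zero}  {suc b} _       = refl
<⇒cmpℕ-lt {suc a} {suc b} (s≤s p) = <⇒cmpℕ-lt p

data Lex {A : Set} (f : A → A → Cmp) (a b : A) (P : Set) : Set where
  fstLt : f a b ≡ lt → Lex f a b P
  fstEq : a ≡ b → P → Lex f a b P

lex-map : ∀ {A : Set} {f : A → A → Cmp} {a b : A} {P Q : Set} →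
          (P → Q) → Lex f a b P → Lex f a b Q
lex-map g (fstLt p)   = fstLt p
lex-map g (fstEq e p) = fstEq e (g p)

lex-trans : ∀ {A : Set} {f : A → A → Cmp} {a b c : A} {P Q R : Set} →
            (f a b ≡ lt → f b c ≡ lt → f a c ≡ lt) → (P → Q → R) →
            Lex f a b P → Lex f b c Q → Lex f a c R
lex-trans t u (fstLt p)      (fstLt q)      = fstLt (t p q)
lex-trans t u (fstLt p)      (fstEq refl _) = fstLt p
lex-trans t u (fstEq refl _) (fstLt q)      = fstLt q
lex-trans t u (fstEq refl p) (fstEq refl q) = fstEq refl (u p q)

module _ {A : Set} (f : A → A → Cmp) where

  lex-view : (∀ a b → f a b ≡ eq → a ≡ b) →
             ∀ a b y → thenCmp (f a b) y ≡ lt → Lex f a b (y ≡ lt)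
  lex-view f-eq a b y p with f a b in e
  lex-view f-eq a b y p  | lt = fstLt e
  lex-view f-eq a b y p  | eq = fstEq (f-eq a b e) p
  lex-view f-eq a b y () | gt

  lex-intro : (∀ a → f a a ≡ eq) →
              ∀ {a b y} → Lex f a b (y ≡ lt) → thenCmp (f a b) y ≡ lt
  lex-intro f-refl (fstLt p) rewrite p = refl
  lex-intro f-refl {a} (fstEq refl q) rewrite f-refl a = q

thenEq : ∀ x y → thenCmp x y ≡ eq → x ≡ eq × y ≡ eq
thenEq eq y p = refl , p
thenEq lt y ()
thenEq gt y ()

mutual
  cmp-refl : ∀ a → cmp a a ≡ eq
  cmp-refl (fin a)   = cmpℕ-refl a
  cmp-refl (nf k ts) rewrite cmpℕ-refl k = cmpL-refl ts

  cmpL-refl : ∀ ts → cmpL ts ts ≡ eq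
  cmpL-refl []             = refl
  cmpL-refl ((a , c) ∷ ts) rewrite cmp-refl a | cmp-refl c = cmpL-refl ts

mutual
  cmp-eq : ∀ a b → cmp a b ≡ eq → a ≡ b
  cmp-eq (fin a)   (fin b)    p = cong fin (cmpℕ-eq a b p)
  cmp-eq (nf k xs) (nf l ys)  p with thenEq (cmpℕ k l) (cmpL xs ys) p
  ... | p₁ , p₂ = cong₂ nf (cmpℕ-eq k l p₁) (cmpL-eq xs ys p₂)
  cmp-eq (fin _)   (nf _ _)  ()
  cmp-eq (nf _ _)  (fin _)   ()

  cmpL-eq : ∀ xs ys → cmpL xs ys ≡ eq → xs ≡ ys
  cmpL-eq []             []             _ = refl
  cmpL-eq ((a , c) ∷ xs) ((b , d) ∷ ys) p with thenEq (cmp a b) _ p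
  ... | p₁ , p₂ with thenEq (cmp c d) _ p₂
  ...   | p₃ , p₄ = cong₂ _∷_ (cong₂ _,_ (cmp-eq a b p₁) (cmp-eq c d p₃)) (cmpL-eq xs ys p₄)
  cmpL-eq []      (_ ∷ _) ()
  cmpL-eq (_ ∷ _) []      ()

-- The lexicographic order on term lists, wrapped in a record so that the
-- two lists can be inferred from a proof.
infix 4 _<L_
record _<L_ (xs ys : List (Tm × Tm)) : Set where
  constructor lexLt
  field unLex : cmpL xs ys ≡ lt
open _<L_

NfLt : ℕ → List (Tm × Tm) → ℕ → List (Tm × Tm) → Set
NfLt j cs k ts = Lex cmpℕ j k (cs <L ts)

nf-view : ∀ j cs k ts → nf j cs <ₒ nf k ts → NfLt j cs k ts
nf-view j cs k ts p = lex-map lexLt (lex-view cmpℕ cmpℕ-eq j k (cmpL cs ts) p)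

nf-intro : ∀ j cs k ts → NfLt j cs k ts → nf j cs <ₒ nf k ts
nf-intro j cs k ts v = lex-intro cmpℕ cmpℕ-refl (lex-map unLex v)

ConsLt : Tm → Tm → List (Tm × Tm) → Tm → Tm → List (Tm × Tm) → Set
ConsLt e c cs e' c' cs' = Lex cmp e e' (Lex cmp c c' (cs <L cs'))

cons-view : ∀ {e c cs e' c' cs'} → (e , c) ∷ cs <L (e' , c') ∷ cs' → ConsLt e c cs e' c' cs'
cons-view {e} {c} {cs} {e'} {c'} {cs'} (lexLt p) =
  lex-map (λ q → lex-map lexLt (lex-view cmp cmp-eq c c' (cmpL cs cs') q))
          (lex-view cmp cmp-eq e e' _ p)

cons-intro : ∀ {e c cs e' c' cs'} → ConsLt e c cs e' c' cs' → (e , c) ∷ cs <L (e' , c') ∷ cs'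
cons-intro v = lexLt (lex-intro cmp cmp-refl (lex-map (λ w → lex-intro cmp cmp-refl (lex-map unLex w)) v))

[]<L∷ : ∀ {t ts} → [] <L t ∷ ts
[]<L∷ = lexLt refl

not-<L-[] : ∀ cs → ¬ (cs <L [])
not-<L-[] []      (lexLt ())
not-<L-[] (_ ∷ _) (lexLt ())

mutual
  <ₒ-trans : ∀ a b c → a <ₒ b → b <ₒ c → a <ₒ c
  <ₒ-trans (fin a)   (fin b)   (fin c)   p q =
    <⇒cmpℕ-lt (<-trans (cmpℕ-lt⇒< a b p) (cmpℕ-lt⇒< b c q))
  <ₒ-trans (fin _)   (fin _)   (nf _ _)  _ _ = refl
  <ₒ-trans (fin _)   (nf _ _)  (nf _ _)  _ _ = refl
  <ₒ-trans (nf j xs) (nf k ys) (nf l zs) p q =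
    nf-intro j xs l zs (lex-trans (ℕ-trans j k l) (<L-trans xs ys zs)
                                  (nf-view j xs k ys p) (nf-view k ys l zs q))
    where
      ℕ-trans : ∀ a b c → cmpℕ a b ≡ lt → cmpℕ b c ≡ lt → cmpℕ a c ≡ lt
      ℕ-trans a b c p q = <⇒cmpℕ-lt (<-trans (cmpℕ-lt⇒< a b p) (cmpℕ-lt⇒< b c q))
  <ₒ-trans (fin _)   (nf _ _)  (fin _)   _ ()
  <ₒ-trans (nf _ _)  (fin _)   _         () _
  <ₒ-trans (nf _ _)  (nf _ _)  (fin _)   _ ()

  <L-trans : ∀ xs ys zs → xs <L ys → ys <L zs → xs <L zs
  <L-trans []             (_ ∷ _)        (_ ∷ _)        _ _ = []<L∷
  <L-trans ((a , c) ∷ xs) ((b , d) ∷ ys) ((e , f) ∷ zs) p q =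
    cons-intro (lex-trans (<ₒ-trans a b e)
                          (lex-trans (<ₒ-trans c d f) (<L-trans xs ys zs))
                          (cons-view p) (cons-view q))
  <L-trans xs      []      _  p _ = ⊥-elim (not-<L-[] xs p)
  <L-trans _       ys      [] _ q = ⊥-elim (not-<L-[] ys q)

towB-mono : ∀ k {i j} → i < j → towB k i <ₒ towB k j
towB-mono k {zero}  {suc j} _       = refl
towB-mono k {suc i} {suc j} (s≤s p) =
  nf-intro k ((towB k i , fin 1) ∷ []) k ((towB k j , fin 1) ∷ [])
           (fstEq refl (cons-intro (fstLt (towB-mono k p))))

below-towB-mono : ∀ a k i j → a <ₒ towB k i → i ≤ j → a <ₒ towB k j
below-towB-mono a k i j p i≤j with m≤n⇒m<n∨m≡n i≤j
... | inj₁ i<j  = <ₒ-trans a (towB k i) (towB k j) p (towB-mono k i<j)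
... | inj₂ refl = p

-- Every normal form of level ≤ k lies below some tower over B_k; this is
-- why the bounded search defining h succeeds.
below-towB-depth : ∀ α k → WF α → lev α ≤ k → α <ₒ towB k (depth α + 2)
below-towB-depth (fin _) k _ _ = refl
below-towB-depth (nf j ((e , c) ∷ ts)) k (_ , _ , we , le , _) j≤k with m≤n⇒m<n∨m≡n j≤k
... | inj₁ j<k  = nf-intro j ((e , c) ∷ ts) k ((towB k (depthL ((e , c) ∷ ts) + 2) , fin 1) ∷ [])
                    (fstLt (<⇒cmpℕ-lt j<k))
... | inj₂ refl = nf-intro j ((e , c) ∷ ts) j ((towB j d , fin 1) ∷ [])
                    (fstEq refl (cons-intro (fstLt
                      (below-towB-mono e j (depth e + 2) d (below-towB-depth e j we le)
                                       (+-monoˡ-≤ 2 (m≤m⊔n (depth e) (depthL ts)))))))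
  where d : ℕ
        d = depthL ((e , c) ∷ ts) + 2

searchFrom-correct : ∀ (P : ℕ → Bool) f s i → i < f → P (i + s) ≡ true →
                     P (searchFrom P s f) ≡ true
searchFrom-correct P (suc f) s i i<f Pi with P s in Ps
... | true = Ps
searchFrom-correct P (suc f) s zero    _         Pi | false =
  ⊥-elim (false≢true (trans (sym Ps) Pi))
  where false≢true : false ≢ true
        false≢true ()
searchFrom-correct P (suc f) s (suc i) (s≤s i<f) Pi | false =
  searchFrom-correct P f (suc s) i i<f (trans (cong P (+-suc i s)) Pi)

isLt-lt : ∀ x → isLt x ≡ true → x ≡ lt
isLt-lt lt _ = refl
isLt-lt eq ()
isLt-lt gt ()

below-towB-h : ∀ α → WF α → α <ₒ towB (lev α) (h α)
below-towB-h α w =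
  isLt-lt _ (searchFrom-correct P (depth α + 3) 0 (depth α + 2)
                                (+-monoʳ-< (depth α) (s≤s (s≤s (s≤s z≤n))))
                                (trans (cong P (+-identityʳ (depth α + 2)))
                                       (cong isLt (below-towB-depth α (lev α) w ≤-refl))))
  where P : ℕ → Bool
        P m = isLt (cmp α (towB (lev α) m))

below-towB : ∀ m n c → WF c → lev c ≤ m → psn c < n → c <ₒ towB m n
below-towB m (suc n) (fin _) _ _ _ = refl
below-towB m (suc n) (nf j ts) w j≤m p with m≤n⇒m<n∨m≡n j≤m
... | inj₁ j<m  = nf-intro j ts m ((towB m n , fin 1) ∷ []) (fstLt (<⇒cmpℕ-lt j<m))
... | inj₂ refl = below-towB-mono (nf j ts) j (h (nf j ts)) (suc n) (below-towB-h (nf j ts) w)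
                    (≤-trans (m≤m⊔n (h (nf j ts)) (psnL ts)) (<⇒≤ p))

below-baseFS : ∀ k n c → WF c → CoefOK k c → psn c < n → c <ₒ baseFS k n
below-baseFS zero    n .(fin (suc a)) _ (a , refl) p = <⇒cmpℕ-lt p
below-baseFS (suc m) n c              w (l , _)    p = below-towB m n c w l p

isZero : ∀ γ → γ ≡ fin 0 ⊎ ¬ γ ≡ fin 0
isZero (fin zero)    = inj₁ refl
isZero (fin (suc _)) = inj₂ λ ()
isZero (nf _ _)      = inj₂ λ ()

nothing-below-zero : ∀ a → ¬ a <ₒ fin 0
nothing-below-zero (fin zero)    ()
nothing-below-zero (fin (suc _)) ()
nothing-below-zero (nf _ _)      ()

zero-below : ∀ e → ¬ e ≡ fin 0 → fin 0 <ₒ e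
zero-below (fin zero)    nz = ⊥-elim (nz refl)
zero-below (fin (suc _)) _  = refl
zero-below (nf _ _)      _  = refl

below-one : ∀ a → a <ₒ fin 1 → a ≡ fin 0
below-one (fin zero)          _ = refl
below-one (fin (suc zero))    ()
below-one (fin (suc (suc _))) ()
below-one (nf _ _)            ()

coef-nonzero : ∀ k {c} → CoefOK k c → ¬ c ≡ fin 0
coef-nonzero zero    (_ , ()) refl
coef-nonzero (suc k) (_ , nz) = nz

coefTerm-nonzero : ∀ ψ γ → ¬ γ ≡ fin 0 → coefTerm ψ γ ≡ (ψ , γ) ∷ []
coefTerm-nonzero ψ (fin zero)    nz = ⊥-elim (nz refl)
coefTerm-nonzero ψ (fin (suc _)) _  = refl
coefTerm-nonzero ψ (nf _ _)      _  = refl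

decr-tail : ∀ t ts → Decr (t ∷ ts) → Decr ts
decr-tail t []      _       = tt
decr-tail t (_ ∷ _) (_ , d) = d

decr-fin0 : ∀ c ts → Decr ((fin 0 , c) ∷ ts) → ts ≡ []
decr-fin0 c []             _       = refl
decr-fin0 c ((e , _) ∷ ts) (p , _) = ⊥-elim (nothing-below-zero e p)

data SucLView : List (Tm × Tm) → Set where
  onNil  : SucLView []
  onLast : ∀ c → SucLView ((fin zero , c) ∷ [])
  onCons : ∀ e c ts → sucL ((e , c) ∷ ts) ≡ (e , c) ∷ sucL ts → SucLView ((e , c) ∷ ts)

sucL-view : ∀ ts → SucLView ts
sucL-view []                           = onNil
sucL-view ((fin zero    , c) ∷ [])     = onLast c
sucL-view ((fin zero    , c) ∷ _ ∷ _)  = onCons _ c _ refl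
sucL-view ((fin (suc _) , c) ∷ [])     = onCons _ c _ refl
sucL-view ((fin (suc _) , c) ∷ _ ∷ _)  = onCons _ c _ refl
sucL-view ((nf _ _      , c) ∷ [])     = onCons _ c _ refl
sucL-view ((nf _ _      , c) ∷ _ ∷ _)  = onCons _ c _ refl

-- sucL keeps the leading exponent, so it preserves LeadOK and Decr backwards
lead-sucL : ∀ L → LeadOK (sucL L) → LeadOK L
lead-sucL L lo with sucL-view L
... | onNil          = lo refl
... | onLast _       = lo
... | onCons _ _ _ s = subst LeadOK s lo

decr-sucL : ∀ e c L → Decr L → Decr ((e , c) ∷ sucL L) → Decr ((e , c) ∷ L)
decr-sucL e c L dL d with sucL-view L
... | onNil          = tt
... | onLast _       = d
... | onCons _ _ _ s = proj₁ (subst (λ M → Decr ((e , c) ∷ M)) s d) , dL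

data MkView (k : ℕ) : List (Tm × Tm) → Set where
  mkNil  : MkView k []
  mkCoef : ∀ x → MkView k ((fin zero , x) ∷ [])
  mkNf   : ∀ L → mk k L ≡ nf k L → MkView k L

mk-view : ∀ k L → MkView k L
mk-view k []                           = mkNil
mk-view k ((fin zero    , c) ∷ [])     = mkCoef c
mk-view k ((fin zero    , c) ∷ _ ∷ _)  = mkNf _ refl
mk-view k ((fin (suc _) , c) ∷ _)      = mkNf _ refl
mk-view k ((nf _ _      , c) ∷ _)      = mkNf _ refl

mapMaybe-just : ∀ {A B : Set} (f : A → B) m {y} → mapMaybe f m ≡ just y →
                Σ A λ x → m ≡ just x × f x ≡ y
mapMaybe-just f (just x) refl = x , refl , refl
mapMaybe-just f nothing  ()

mapMaybe-nothing : ∀ {A B : Set} (f : A → B) m → mapMaybe f m ≡ nothing → m ≡ nothing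
mapMaybe-nothing f nothing  _ = refl
mapMaybe-nothing f (just _) ()

predL-cons : ∀ t t' ts → predL (t ∷ t' ∷ ts) ≡ mapMaybe (t ∷_) (predL (t' ∷ ts))
predL-cons (fin zero    , _) t' ts = refl
predL-cons (fin (suc _) , _) t' ts = refl
predL-cons (nf _ _      , _) t' ts = refl

predC-nonzero : ∀ γ → ¬ γ ≡ fin 0 → predC (just γ) ≡ just ((fin zero , γ) ∷ [])
predC-nonzero (fin zero)    nz = ⊥-elim (nz refl)
predC-nonzero (fin (suc _)) _  = refl
predC-nonzero (nf _ _)      _  = refl

coef-pred : ∀ k γ → CoefOK k (sucT γ) → ¬ γ ≡ fin 0 → CoefOK k γ
coef-pred zero    (fin zero)    _       nz = ⊥-elim (nz refl)
coef-pred zero    (fin (suc b)) _       _  = b , refl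
coef-pred zero    (nf _ _)      (_ , ()) _
coef-pred (suc m) (fin _)       _       nz = z≤n , nz
coef-pred (suc m) (nf _ _)      (l , _) nz = l , nz

predL-last : ∀ k γ L → WF γ → CoefOK k (sucT γ) → predC (just γ) ≡ just L →
             Decr L × WFL k L × sucL L ≡ (fin zero , sucT γ) ∷ []
predL-last k γ L wγ c eL with isZero γ
... | inj₁ refl with eL
...   | refl = tt , tt , refl
predL-last k γ L wγ c eL | inj₂ nz with trans (sym eL) (predC-nonzero γ nz)
...   | refl = tt , (tt , z≤n , wγ , coef-pred k γ c nz , tt) , refl

pred-nf : ∀ k ts L → LeadOK ts → Decr L × WFL k L × sucL L ≡ ts → WF (mk k L) × sucT (mk k L) ≡ nf k ts
pred-nf k ts L lo (dL , wL , sL) with mk-view k L | lead-sucL L (subst LeadOK (sym sL) lo)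
... | mkNil    | ()
... | mkCoef _ | loL = ⊥-elim (loL refl)
... | mkNf _ e | loL rewrite e = (loL , dL , wL) , cong (nf k) sL

predL-cons-suc : ∀ k e c t ts L → Decr ((e , c) ∷ t ∷ ts) →
                 WF e × lev e ≤ k × WF c × CoefOK k c →
                 Decr L × WFL k L × sucL L ≡ t ∷ ts →
                 Decr ((e , c) ∷ L) × WFL k ((e , c) ∷ L) × sucL ((e , c) ∷ L) ≡ (e , c) ∷ t ∷ ts
predL-cons-suc k e c t ts L d (we , le , wc , cc) (dL , wL , sL) with sucL-view ((e , c) ∷ L)
... | onCons _ _ _ s = decr-sucL e c L dL (subst (λ M → Decr ((e , c) ∷ M)) (sym sL) d) ,
                       (we , le , wc , cc , wL) , trans s (cong ((e , c) ∷_) sL)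
... | onLast _ = ⊥-elim (nothing-below-zero (proj₁ t) (proj₁ d))

mutual
  pred-suc : ∀ ξ γ → WF ξ → predOf ξ ≡ just γ → WF γ × sucT γ ≡ ξ
  pred-suc (fin (suc a)) .(fin a) _ refl = tt , refl
  pred-suc (nf k ts) γ (lo , d , w) p =
    let (L , eL , mkL) = mapMaybe-just (mk k) (predL ts) p
    in subst (λ g → WF g × sucT g ≡ nf k ts) mkL (pred-nf k ts L lo (predL-suc k ts L d w eL))
  pred-suc (fin zero) γ _ ()

  predL-suc : ∀ k ts L → Decr ts → WFL k ts → predL ts ≡ just L →
              Decr L × WFL k L × sucL L ≡ ts
  predL-suc k ((fin zero , ξ) ∷ []) L _ (_ , _ , wξ , cξ , _) eL =
    predL-zero k ξ L (predOf ξ) refl wξ cξ eL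
  predL-suc k ((e , c) ∷ t ∷ ts) L d (we , le , wc , cc , w) eL =
    let (L' , eL' , consL) = mapMaybe-just ((e , c) ∷_) (predL (t ∷ ts))
                               (trans (sym (predL-cons (e , c) t ts)) eL)
    in subst (λ M → Decr M × WFL k M × sucL M ≡ (e , c) ∷ t ∷ ts) consL
             (predL-cons-suc k e c t ts L' d (we , le , wc , cc)
                             (predL-suc k (t ∷ ts) L' (decr-tail (e , c) (t ∷ ts) d) w eL'))
  predL-suc k [] L _ _ ()
  predL-suc k ((fin (suc _) , _) ∷ []) L _ _ ()
  predL-suc k ((nf _ _      , _) ∷ []) L _ _ ()

  -- the case ts = [(0 , ξ)]; predOf ξ is passed as an argument to keep the
  -- recursion structural
  predL-zero : ∀ k ξ L m → predOf ξ ≡ m → WF ξ → CoefOK k ξ → predC m ≡ just L →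
               Decr L × WFL k L × sucL L ≡ (fin zero , ξ) ∷ []
  predL-zero k ξ L (just γ) eqp wξ cξ eL with pred-suc ξ γ wξ eqp
  ... | wγ , refl = predL-last k γ L wγ cξ eL

limit-no-pred : ∀ β → WF β → IsLimit β → predOf β ≡ nothing
limit-no-pred β wβ (_ , not-suc) with predOf β in eqp
... | nothing = refl
... | just γ with pred-suc β γ wβ eqp
...   | wγ , sγ = ⊥-elim (not-suc γ wγ sγ)

below-suc-fin : ∀ a b → fin b <ₒ sucT (fin a) → fin b <ₒ fin a ⊎ fin b ≡ fin a
below-suc-fin a b p with m≤n⇒m<n∨m≡n (≤-pred (cmpℕ-lt⇒< b (suc a) p))
... | inj₁ b<a  = inj₁ (<⇒cmpℕ-lt b<a)
... | inj₂ refl = inj₂ refl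

below-suc-nf : ∀ j cs k ts → NfLt j cs k (sucL ts) →
               (j ≡ k → cs <L sucL ts → cs <L ts ⊎ cs ≡ ts) →
               nf j cs <ₒ nf k ts ⊎ nf j cs ≡ nf k ts
below-suc-nf j cs k ts (fstLt q)      _ = inj₁ (nf-intro j cs k ts (fstLt q))
below-suc-nf j cs k ts (fstEq refl q) below-ts with below-ts refl q
... | inj₁ r    = inj₁ (nf-intro j cs j ts (fstEq refl r))
... | inj₂ refl = inj₂ refl

below-sucL-nil : ∀ k cs → WFL k cs → cs <L sucL [] → cs ≡ []
below-sucL-nil k []             _                  _ = refl
below-sucL-nil k ((e , d) ∷ cs) (_ , _ , _ , cd , _) p with cons-view p
... | fstLt q                   = ⊥-elim (nothing-below-zero e q)
... | fstEq refl (fstLt q)      = ⊥-elim (coef-nonzero k cd (below-one d q))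
... | fstEq refl (fstEq refl q) = ⊥-elim (not-<L-[] cs q)

below-sucL-last : ∀ k c cs → Decr cs → WFL k cs →
                  (∀ d → WF d → d <ₒ sucT c → d <ₒ c ⊎ d ≡ c) →
                  cs <L (fin zero , sucT c) ∷ [] →
                  cs <L (fin zero , c) ∷ [] ⊎ cs ≡ (fin zero , c) ∷ []
below-sucL-last k c []             _   _                  _       _ = inj₁ []<L∷
below-sucL-last k c ((e , d) ∷ cs) dcs (_ , _ , wd , _) below-c p with cons-view p
... | fstLt q                   = ⊥-elim (nothing-below-zero e q)
... | fstEq refl (fstEq refl q) = ⊥-elim (not-<L-[] cs q)
... | fstEq refl (fstLt q) with below-c d wd q
...   | inj₁ r    = inj₁ (cons-intro (fstEq refl (fstLt r)))
...   | inj₂ refl rewrite decr-fin0 d cs dcs = inj₂ refl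

below-sucL-cons : ∀ k e c ts cs → Decr cs → WFL k cs →
                  (∀ cs' → Decr cs' → WFL k cs' → cs' <L sucL ts → cs' <L ts ⊎ cs' ≡ ts) →
                  cs <L (e , c) ∷ sucL ts → cs <L (e , c) ∷ ts ⊎ cs ≡ (e , c) ∷ ts
below-sucL-cons k e c ts []              _   _                      _     _ = inj₁ []<L∷
below-sucL-cons k e c ts ((e' , d) ∷ cs) dcs (_ , _ , _ , _ , wcs) below-ts p with cons-view p
... | fstLt q              = inj₁ (cons-intro (fstLt q))
... | fstEq refl (fstLt q) = inj₁ (cons-intro (fstEq refl (fstLt q)))
... | fstEq refl (fstEq refl q) with below-ts cs (decr-tail _ cs dcs) wcs q
...   | inj₁ r    = inj₁ (cons-intro (fstEq refl (fstEq refl r)))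
...   | inj₂ refl = inj₂ refl

below-sucL-step : ∀ k e c ts cs → SucLView ((e , c) ∷ ts) → Decr cs → WFL k cs →
                  (∀ d → WF d → d <ₒ sucT c → d <ₒ c ⊎ d ≡ c) →
                  (∀ cs' → Decr cs' → WFL k cs' → cs' <L sucL ts → cs' <L ts ⊎ cs' ≡ ts) →
                  cs <L sucL ((e , c) ∷ ts) → cs <L (e , c) ∷ ts ⊎ cs ≡ (e , c) ∷ ts
below-sucL-step k _ c _  cs (onLast _)       dcs wcs below-c _        p =
  below-sucL-last k c cs dcs wcs below-c p
below-sucL-step k e c ts cs (onCons _ _ _ s) dcs wcs _       below-ts p =
  below-sucL-cons k e c ts cs dcs wcs below-ts (subst (cs <L_) s p)

mutual
  below-suc : ∀ γ c → WF γ → WF c → c <ₒ sucT γ → c <ₒ γ ⊎ c ≡ γ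
  below-suc (fin a)   (fin b)   _ _ p = below-suc-fin a b p
  below-suc (nf k ts) (fin b)   _ _ _ = inj₁ refl
  below-suc (nf k ts) (nf j cs) (_ , _ , wts) (_ , dcs , wcs) p =
    below-suc-nf j cs k ts (nf-view j cs k (sucL ts) p)
      (λ j≡k → below-sucL k ts cs wts dcs (subst (λ i → WFL i cs) j≡k wcs))
  below-suc (fin a)   (nf _ _)  _ _ ()

  below-sucL : ∀ k ts cs → WFL k ts → Decr cs → WFL k cs → cs <L sucL ts → cs <L ts ⊎ cs ≡ ts
  below-sucL k [] cs _ _ wcs p = inj₂ (below-sucL-nil k cs wcs p)
  below-sucL k ((e , c) ∷ ts) cs (_ , _ , wc , _ , wts) dcs wcs p =
    below-sucL-step k e c ts cs (sucL-view ((e , c) ∷ ts)) dcs wcs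
      (λ d wd → below-suc c d wc wd)
      (λ cs' dcs' wcs' → below-sucL k ts cs' wts dcs' wcs') p

below-pred : ∀ ξ γ c → WF ξ → WF c → predOf ξ ≡ just γ → c <ₒ ξ → c <ₒ γ ⊎ c ≡ γ
below-pred ξ γ c wξ wc eqp p with pred-suc ξ γ wξ eqp
... | wγ , refl = below-suc γ c wγ wc p

psn-exp : ∀ {n} e c cs → psnL ((e , c) ∷ cs) < n → psn e < n
psn-exp e c cs p = m⊔n<o⇒m<o (psn e) (psn c) (m⊔n<o⇒m<o (psn e ⊔ psn c) (psnL cs) p)

psn-coef : ∀ {n} e c cs → psnL ((e , c) ∷ cs) < n → psn c < n
psn-coef e c cs p = m⊔n<o⇒n<o (psn e) (psn c) (m⊔n<o⇒m<o (psn e ⊔ psn c) (psnL cs) p)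

psn-tail : ∀ {n} e c cs → psnL ((e , c) ∷ cs) < n → psnL cs < n
psn-tail e c cs p = m⊔n<o⇒n<o (psn e ⊔ psn c) (psnL cs) p

positive-nonzero : ∀ {x} → fin 0 <ₒ x → ¬ x ≡ fin 0
positive-nonzero p e = nothing-below-zero (fin 0) (subst (fin 0 <ₒ_) e p)

zero-below-baseFS : ∀ k n → 0 < n → fin 0 <ₒ baseFS k n
zero-below-baseFS zero    n       0<n = <⇒cmpℕ-lt 0<n
zero-below-baseFS (suc m) zero    ()
zero-below-baseFS (suc m) (suc n) _   = refl

fsPow'-limit : ∀ k ψ n → ¬ ψ ≡ fin 0 → fsPow' k ψ nothing n ≡ (fs ψ n , fin 1) ∷ []
fsPow'-limit k (fin zero)    n nz = ⊥-elim (nz refl)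
fsPow'-limit k (fin (suc _)) n _  = refl
fsPow'-limit k (nf _ _)      n _  = refl

coef-fin : ∀ k a → CoefOK k (fin (suc a))
coef-fin zero    a = a , refl
coef-fin (suc k) a = z≤n , λ ()

coef-lower : ∀ k j cs → j < k → CoefOK k (nf j cs)
coef-lower (suc k) j cs (s≤s j≤k) = j≤k , λ ()

[]<L-lead : ∀ ts → LeadOK ts → [] <L ts
[]<L-lead (_ ∷ _) _ = []<L∷

coef<L-lead : ∀ c ts → LeadOK ts → (fin zero , c) ∷ [] <L ts
coef<L-lead c ((e , _) ∷ _) lo = cons-intro (fstLt (zero-below e lo))

lead-not<L-coef : ∀ cs x → LeadOK cs → ¬ cs <L (fin zero , x) ∷ []
lead-not<L-coef ((e , d) ∷ cs) x lo p with cons-view p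
... | fstLt q    = nothing-below-zero e q
... | fstEq e≡0 _ = lo e≡0

-- ψ = 0 together with a successor coefficient would make the list a successor
succ-coef-exp-nonzero : ∀ ψ ξ γ → predL ((ψ , ξ) ∷ []) ≡ nothing → predOf ξ ≡ just γ → ¬ ψ ≡ fin 0
succ-coef-exp-nonzero .(fin zero) ξ γ pl eqp refl rewrite eqp = predC-just γ pl
  where predC-just : ∀ γ → ¬ predC (just γ) ≡ nothing
        predC-just (fin zero)    ()
        predC-just (fin (suc _)) ()
        predC-just (nf _ _)      ()

tail-no-pred : ∀ t t' ts → predL (t ∷ t' ∷ ts) ≡ nothing → predL (t' ∷ ts) ≡ nothing
tail-no-pred t t' ts pl = mapMaybe-nothing (t ∷_) _ (trans (sym (predL-cons t t' ts)) pl)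

HeadBelow : Tm → List (Tm × Tm) → Set
HeadBelow ψ []            = ⊤
HeadBelow ψ ((e , _) ∷ _) = e <ₒ ψ

head-below : ∀ e d cs → Decr ((e , d) ∷ cs) → HeadBelow e cs
head-below e d []      _       = tt
head-below e d (_ ∷ _) (p , _) = p

module FundamentalSequence (n : ℕ) (1<n : 1 < n) where

  0<n : 0 < n
  0<n = <-trans (s≤s z≤n) 1<n

  Admissible : ℕ → List (Tm × Tm) → Set
  Admissible k cs = Decr cs × WFL k cs × psnL cs < n

  Claim : Tm → Set
  Claim β = ∀ α → WF α → α <ₒ β → psn α < n → α <ₒ fs β n

  Covers : ℕ → List (Tm × Tm) → List (Tm × Tm) → Set
  Covers k ts R = ∀ cs → Admissible k cs → cs <L ts → cs <L R

  PowerClaim : ℕ → Tm → Set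
  PowerClaim k ψ = ∀ cs → Admissible k cs → HeadBelow ψ cs → cs <L fsPow k ψ n

  -- all terms but the last are kept by the fundamental sequence
  covers-cons : ∀ k t ts R → Covers k ts R → Covers k (t ∷ ts) (t ∷ R)
  covers-cons k t       ts R cov []              _ _ = []<L∷
  covers-cons k (e , c) ts R cov ((e' , d) ∷ cs) (dcs , (_ , _ , _ , _ , wcs) , pcs) p
    with cons-view p
  ... | fstLt q              = cons-intro (fstLt q)
  ... | fstEq refl (fstLt q) = cons-intro (fstEq refl (fstLt q))
  ... | fstEq refl (fstEq refl q) =
        cons-intro (fstEq refl (fstEq refl (cov cs (decr-tail _ cs dcs , wcs , psn-tail e' d cs pcs) q)))

  -- B^ψ[n] = B^(ψ[n]) for limit ψ: compare leading exponents via the claim for ψ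
  power-limit : ∀ k ψ → Claim ψ → ∀ cs → Admissible k cs → HeadBelow ψ cs →
                cs <L (fs ψ n , fin 1) ∷ []
  power-limit k ψ claim-ψ []             _                    _  = []<L∷
  power-limit k ψ claim-ψ ((e , d) ∷ cs) (_ , (we , _) , pcs) hb =
    cons-intro (fstLt (claim-ψ e we hb (psn-exp e d cs pcs)))

  -- B^(γ+1)[n] = B^γ · B_k[n]: an exponent below γ + 1 is below γ or equal to
  -- it, and then the coefficient is below B_k[n]
  power-succ : ∀ k ψ γ → WF ψ → predOf ψ ≡ just γ → ∀ cs → Admissible k cs → HeadBelow ψ cs →
               cs <L (γ , baseFS k n) ∷ []
  power-succ k ψ γ wψ eqp []             _ _ = []<L∷
  power-succ k ψ γ wψ eqp ((e , d) ∷ cs) (_ , (we , _ , wd , cd , _) , pcs) hb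
    with below-pred ψ γ e wψ we eqp hb
  ... | inj₁ e<γ  = cons-intro (fstLt e<γ)
  ... | inj₂ refl = cons-intro (fstEq refl (fstLt (below-baseFS k n d wd cd (psn-coef e d cs pcs))))

  power-step : ∀ k ψ → WF ψ → ¬ ψ ≡ fin 0 → (predOf ψ ≡ nothing → Claim ψ) → PowerClaim k ψ
  power-step k ψ wψ nz claim-ψ cs adm hb with predOf ψ in eqp
  ... | nothing rewrite fsPow'-limit k ψ n nz = power-limit k ψ (claim-ψ refl) cs adm hb
  ... | just γ  rewrite coefTerm-nonzero γ (baseFS k n)
                          (positive-nonzero (zero-below-baseFS k n 0<n)) =
        power-succ k ψ γ wψ eqp cs adm hb

  covers-limit-coef : ∀ k ψ ξ → ¬ ξ ≡ fin 0 → Claim ξ →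
                      Covers k ((ψ , ξ) ∷ []) (coefTerm ψ (fs ξ n))
  covers-limit-coef k ψ ξ nz claim-ξ =
    subst (Covers k ((ψ , ξ) ∷ [])) (sym (coefTerm-nonzero ψ (fs ξ n) fsξ-nonzero)) below
    where
      fsξ-nonzero : ¬ fs ξ n ≡ fin 0
      fsξ-nonzero = positive-nonzero (claim-ξ (fin 0) tt (zero-below ξ nz) 0<n)

      below : Covers k ((ψ , ξ) ∷ []) ((ψ , fs ξ n) ∷ [])
      below []             _ _ = []<L∷
      below ((e , d) ∷ cs) (_ , (_ , _ , wd , _) , pcs) p with cons-view p
      ... | fstLt q                   = cons-intro (fstLt q)
      ... | fstEq refl (fstLt q)      =
            cons-intro (fstEq refl (fstLt (claim-ξ d wd q (psn-coef e d cs pcs))))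
      ... | fstEq refl (fstEq refl q) = ⊥-elim (not-<L-[] cs q)

  covers-unit-coef : ∀ k ψ → PowerClaim k ψ → Covers k ((ψ , fin 1) ∷ []) (fsPow k ψ n)
  covers-unit-coef k ψ power-ψ []             adm _ = power-ψ [] adm tt
  covers-unit-coef k ψ power-ψ ((e , d) ∷ cs) adm@(_ , (_ , _ , _ , cd , _) , _) p
    with cons-view p
  ... | fstLt q                   = power-ψ _ adm q
  ... | fstEq refl (fstLt q)      = ⊥-elim (coef-nonzero k cd (below-one d q))
  ... | fstEq refl (fstEq refl q) = ⊥-elim (not-<L-[] cs q)

  covers-succ-coef : ∀ k ψ γ → WF γ → PowerClaim k ψ →
                     Covers k ((ψ , sucT γ) ∷ []) ((ψ , γ) ∷ fsPow k ψ n)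
  covers-succ-coef k ψ γ wγ power-ψ []             _ _ = []<L∷
  covers-succ-coef k ψ γ wγ power-ψ ((e , d) ∷ cs) (dcs , (_ , _ , wd , _ , wcs) , pcs) p
    with cons-view p
  ... | fstLt q                   = cons-intro (fstLt q)
  ... | fstEq refl (fstEq refl q) = ⊥-elim (not-<L-[] cs q)
  ... | fstEq refl (fstLt q) with below-suc γ d wγ wd q
  ...   | inj₁ d<γ  = cons-intro (fstEq refl (fstLt d<γ))
  ...   | inj₂ refl = cons-intro (fstEq refl (fstEq refl
                        (power-ψ cs (decr-tail _ cs dcs , wcs , psn-tail e d cs pcs) (head-below e d cs dcs))))

  covers-last : ∀ k ψ ξ → WF ξ → CoefOK k ξ → predL ((ψ , ξ) ∷ []) ≡ nothing →
                (predOf ξ ≡ nothing → Claim ξ) → (¬ ψ ≡ fin 0 → PowerClaim k ψ) →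
                Covers k ((ψ , ξ) ∷ []) (fsTerm k ψ ξ (predOf ξ) n)
  covers-last k ψ ξ wξ cξ pl claim-ξ power-ψ with predOf ξ in eqp
  ... | nothing = covers-limit-coef k ψ ξ (coef-nonzero k cξ) (claim-ξ refl)
  ... | just γ with pred-suc ξ γ wξ eqp | isZero γ
  ...   | _  , refl | inj₁ refl = covers-unit-coef k ψ (power-ψ (succ-coef-exp-nonzero ψ _ _ pl eqp))
  ...   | wγ , refl | inj₂ γnz rewrite coefTerm-nonzero ψ γ γnz =
          covers-succ-coef k ψ γ wγ (power-ψ (succ-coef-exp-nonzero ψ _ _ pl eqp))

  below-nf-form : ∀ k ts R → Covers k ts R → ∀ α → WF α → α <ₒ nf k ts → psn α < n → α <ₒ nf k R
  below-nf-form k ts R cov (fin _)   _             _ _  = refl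
  below-nf-form k ts R cov (nf j cs) (_ , dcs , wcs) p pα with nf-view j cs k ts p
  ... | fstLt q      = nf-intro j cs k R (fstLt q)
  ... | fstEq refl q = nf-intro j cs j R (fstEq refl (cov cs (dcs , wcs , m⊔n<o⇒n<o _ _ pα) q))

  -- when β[n] collapses to a coefficient x < B_k (the term list [(0 , x)]),
  -- α < x is obtained by viewing α as the coefficient of B_k^0
  below-collapse : ∀ k ts x → LeadOK ts → Covers k ts ((fin zero , x) ∷ []) →
                   ∀ α → WF α → α <ₒ nf k ts → psn α < n → α <ₒ x
  below-collapse k ts x lo cov = below
    where
      as-coef : ∀ c → WF c → CoefOK k c → psn c < n → c <ₒ x
      as-coef c wc cc pc with cons-view (cov ((fin zero , c) ∷ [])
                                (tt , (tt , z≤n , wc , cc , tt) , subst (_< n) (sym (⊔-identityʳ (psn c))) pc)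
                                (coef<L-lead c ts lo))
      ... | fstLt q             = ⊥-elim (nothing-below-zero (fin zero) q)
      ... | fstEq _ (fstLt q)   = q
      ... | fstEq _ (fstEq _ q) = ⊥-elim (not-<L-[] [] q)

      below : ∀ α → WF α → α <ₒ nf k ts → psn α < n → α <ₒ x
      below (fin zero)    _  _ _  = <ₒ-trans (fin 0) (fin 1) x refl (as-coef (fin 1) tt (coef-fin k 0) 1<n)
      below (fin (suc a)) wα _ pα = as-coef (fin (suc a)) wα (coef-fin k a) pα
      below (nf j cs)     wα@(loα , dcs , wcs) p pα with nf-view j cs k ts p
      ... | fstLt q      = as-coef (nf j cs) wα (coef-lower k j cs (cmpℕ-lt⇒< j k q)) pα
      ... | fstEq refl q = ⊥-elim (lead-not<L-coef cs x loα (cov cs (dcs , wcs , m⊔n<o⇒n<o _ _ pα) q))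

  claim-from-covers : ∀ k ts R → LeadOK ts → Covers k ts R →
                      ∀ α → WF α → α <ₒ nf k ts → psn α < n → α <ₒ mk k R
  claim-from-covers k ts R lo cov α wα p pα with mk-view k R
  ... | mkNil    = ⊥-elim (not-<L-[] [] (cov [] (tt , tt , 0<n) ([]<L-lead ts lo)))
  ... | mkCoef x = below-collapse k ts x lo cov α wα p pα
  ... | mkNf _ e rewrite e = below-nf-form k ts R cov α wα p pα

  -- The induction: claim for a limit normal form, covers for the term list of
  -- a limit, power for B^ψ; each call is on a smaller part of β.
  mutual
    claim : ∀ β → WF β → predOf β ≡ nothing → ¬ β ≡ fin 0 → Claim β
    claim (nf k ts) (lo , d , w) pβ _ =
      claim-from-covers k ts (fsL k ts n) lo (covers k ts d w (mapMaybe-nothing (mk k) (predL ts) pβ))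
    claim (fin zero)    _ _  nz = ⊥-elim (nz refl)
    claim (fin (suc _)) _ () _

    covers : ∀ k ts → Decr ts → WFL k ts → predL ts ≡ nothing → Covers k ts (fsL k ts n)
    covers k [] _ _ _ cs _ p = ⊥-elim (not-<L-[] cs p)
    covers k ((ψ , ξ) ∷ []) _ (wψ , _ , wξ , cξ , _) pl =
      covers-last k ψ ξ wξ cξ pl (λ pξ → claim ξ wξ pξ (coef-nonzero k cξ)) (power k ψ wψ)
    covers k (t ∷ t' ∷ ts) d (_ , _ , _ , _ , w) pl =
      covers-cons k t (t' ∷ ts) (fsL k (t' ∷ ts) n)
        (covers k (t' ∷ ts) (decr-tail t (t' ∷ ts) d) w (tail-no-pred t t' ts pl))

    power : ∀ k ψ → WF ψ → ¬ ψ ≡ fin 0 → PowerClaim k ψ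
    power k ψ wψ nz = power-step k ψ wψ nz (λ pψ → claim ψ wψ pψ nz)

mainTheorem5 : (β α : Tm) (n : ℕ) → WF β → IsLimit β → WF α → α <ₒ β →
                 1 < n → psn α < n → α <ₒ fs β n
mainTheorem5 β α n wβ lim wα α<β 1<n psnα<n =
  FundamentalSequence.claim n 1<n β wβ (limit-no-pred β wβ lim) (proj₁ lim) α wα α<β psnα<n
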